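{- If $G$ is a split interval graph, then $t(\overline{G})\le 2$.
   Context: All graphs are finite, simple and undirected; $\overline{G}$ is the complement of $G$. A split interval graph is a graph that is both a split graph (vertex set partitionable into a clique and an independent set) and an interval graph (intersection graph of closed real intervals). A threshold graph is a graph $G=(V,E)$ admitting a real $S$ and $w:V\to\mathbb{R}$ with distinct $u,v$ adjacent iff $w(u)+w(v)\ge S$. The threshold dimension $t(G)$ is the least $k$ such that there are threshold graphs $G_1,\dots,G_k$ on $V(G)$ with $E(G)=\bigcup_i E(G_i)$.
   Formalization: The intervals representing G have rational endpoints instead of real ones, and the weights and the threshold S of the covering threshold graphs are taken in ℚ. -}

module Defs where

open import Data.Nat using (ℕ)
open import Data.Fin using (Fin; _≟_)
open import Data.Bool using (Bool; true; false; not; if_then_else_)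
open import Data.Rational using (ℚ; _≤_; _+_)
open import Data.Product using (Σ; ∃; ∃-syntax; _×_; _,_)
open import Relation.Nullary using (¬_; yes; no)
open import Relation.Binary.PropositionalEquality using (_≡_; refl; sym; cong)
open import Function.Bundles using (_⇔_)

record Graph (n : ℕ) : Set where
  field
    adj    : Fin n → Fin n → Bool
    symm   : ∀ u v → adj u v ≡ adj v u
    irrefl : ∀ v → adj v v ≡ false
open Graph public

Adj : ∀ {n} → Graph n → Fin n → Fin n → Set
Adj G u v = adj G u v ≡ true

private
  cadj : ∀ {n} → Graph n → Fin n → Fin n → Bool
  cadj G u v with u ≟ v
  ... | yes _ = false
  ... | no  _ = not (adj G u v)

  csym : ∀ {n} (G : Graph n) u v → cadj G u v ≡ cadj G v u
  csym G u v with u ≟ v | v ≟ u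
  ... | yes _ | yes _ = refl
  ... | yes refl | no q = Relation.Nullary.contradiction refl q
    where import Relation.Nullary
  ... | no p | yes refl = Relation.Nullary.contradiction refl p
    where import Relation.Nullary
  ... | no _ | no _ = cong not (symm G u v)

  cirr : ∀ {n} (G : Graph n) v → cadj G v v ≡ false
  cirr G v with v ≟ v
  ... | yes _ = refl
  ... | no p = Relation.Nullary.contradiction refl p
    where import Relation.Nullary

complement : ∀ {n} → Graph n → Graph n
complement G = record { adj = cadj G ; symm = csym G ; irrefl = cirr G }

IsSplit : ∀ {n} → Graph n → Set
IsSplit {n} G = Σ (Fin n → Bool) λ inK →
    (∀ u v → ¬ (u ≡ v) → inK u ≡ true → inK v ≡ true → Adj G u v)
  × (∀ u v → inK u ≡ false → inK v ≡ false → ¬ Adj G u v)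

IsInterval : ∀ {n} → Graph n → Set
IsInterval {n} G = Σ (Fin n → ℚ) λ l → Σ (Fin n → ℚ) λ r →
    (∀ v → l v ≤ r v)
  × (∀ u v → ¬ (u ≡ v) → Adj G u v ⇔ (l u ≤ r v × l v ≤ r u))

IsSplitInterval : ∀ {n} → Graph n → Set
IsSplitInterval G = IsSplit G × IsInterval G

IsThreshold : ∀ {n} → Graph n → Set
IsThreshold {n} G = Σ ℚ λ S → Σ (Fin n → ℚ) λ w →
  ∀ u v → ¬ (u ≡ v) → Adj G u v ⇔ (S ≤ w u + w v)

HasThresholdCover : ∀ {n} → Graph n → ℕ → Set
HasThresholdCover {n} G k = Σ (Fin k → Graph n) λ Gs →
    (∀ i → IsThreshold (Gs i))
  × (∀ u v → Adj G u v ⇔ (∃[ i ] Adj (Gs i) u v))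

ThresholdDimAtMost : ∀ {n} → Graph n → ℕ → Set
ThresholdDimAtMost G m = ∃[ k ] (k Data.Nat.≤ m × HasThresholdCover G k)
  where import Data.Nat

{-# OPTIONS --safe #-}
module Submission where

-- Let K be the clique and I the independent set of the split partition.  In the
-- complement, K is independent, I is complete, and u ∈ K, v ∈ I are adjacent iff
-- their intervals are disjoint, i.e. v's interval lies entirely to the left or
-- entirely to the right of u's.  Each of these two relations, together with the
-- clique on I, is a threshold graph: with ε the least positive gap l a − r b, the
-- condition r v < l u reads 0 ≤ l u − (r v + ε), a sum of a weight of u and a
-- weight of v, and shifting the weights on K down and those on I up by a large
-- constant makes K independent and I complete without changing the K–I sums.

open import Defs
open import Data.Nat using (ℕ)
open import Data.Nat.Properties using () renaming (≤-refl to ℕ-≤-refl)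
open import Data.Fin using (Fin; zero; suc; _≟_)
open import Data.Bool using (Bool; true; false; not; _∧_; if_then_else_)
open import Data.Empty using (⊥-elim)
open import Data.Product using (∃-syntax; _×_; _,_; proj₁; proj₂)
open import Data.Sum using (_⊎_; inj₁; inj₂; [_,_])
open import Data.Sum.Function.Propositional using (_⊎-⇔_)
open import Data.Vec.Functional using ([]; _∷_)
open import Function.Base using (_∘_)
open import Function.Bundles using (_⇔_; mk⇔; Equivalence)
open import Function.Construct.Composition using (_⇔-∘_)
open import Function.Construct.Symmetry using (⇔-sym)
open import Function.Related.TypeIsomorphisms using (¬-cong-⇔)
open import Relation.Nullary using (¬_; yes; no)
open import Relation.Nullary.Decidable using (⌊_⌋)
open import Relation.Binary.PropositionalEquality
  using (_≡_; _≢_; refl; sym; trans; cong; cong₂; subst; subst₂)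
open import Data.Rational using (ℚ; 0ℚ; 1ℚ; _+_; _-_; -_; _≤_; _<_; _⊔_; _⊓_)
open import Data.Rational.Properties
  using (_≤?_; _<?_; ≤-refl; ≤-trans; <-≤-trans; ≤-<-trans; <⇒≤; ≰⇒>; <-irrefl; positive⁻¹;
         +-comm; +-identityˡ; +-identityʳ; +-inverseʳ;
         +-mono-≤; +-mono-<; +-monoˡ-≤; +-monoʳ-≤; +-monoˡ-<; +-monoʳ-<;
         p≤p⊔q; p≤q⊔p; p≤q⇒p≤r⊔q; p⊓q≤p; p≤q⇒r⊓p≤q; ⊓-sel)
open import Data.Rational.Solver using (module +-*-Solver)
open +-*-Solver using (solve; _:=_; _:+_; _:-_)

open Equivalence using (to; from)

private variable
  n : ℕ

<⇒≱ : ∀ {p q} → p < q → ¬ (q ≤ p)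
<⇒≱ p<q q≤p = <-irrefl refl (<-≤-trans p<q q≤p)

p<q⇒0<q-p : ∀ {p q} → p < q → 0ℚ < q - p
p<q⇒0<q-p {p} {q} p<q = subst (_< q - p) (+-inverseʳ p) (+-monoˡ-< (- p) p<q)

p≤q⇒0≤q-p : ∀ {p q} → p ≤ q → 0ℚ ≤ q - p
p≤q⇒0≤q-p {p} {q} p≤q = subst (_≤ q - p) (+-inverseʳ p) (+-monoˡ-≤ (- p) p≤q)

0≤q-p⇒p≤q : ∀ {p q} → 0ℚ ≤ q - p → p ≤ q
0≤q-p⇒p≤q {p} {q} 0≤q-p =
  subst₂ _≤_ (+-identityˡ p) (solve 2 (λ p q → q :- p :+ p := q) refl p q) (+-monoˡ-≤ p 0≤q-p)

p<q⇒p-q<0 : ∀ {p q} → p < q → p - q < 0ℚ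
p<q⇒p-q<0 {p} {q} p<q = subst (p - q <_) (+-inverseʳ q) (+-monoˡ-< (- q) p<q)

-p≤q⇒0≤p+q : ∀ {p q} → - p ≤ q → 0ℚ ≤ p + q
-p≤q⇒0≤p+q {p} {q} -p≤q = subst (_≤ p + q) (+-inverseʳ p) (+-monoʳ-≤ p -p≤q)

p<p+q : ∀ p {q} → 0ℚ < q → p < p + q
p<p+q p {q} 0<q = subst (_< p + q) (+-identityʳ p) (+-monoʳ-< p 0<q)

p<q⇒p<r⇒p<q⊓r : ∀ {p q r} → p < q → p < r → p < q ⊓ r
p<q⇒p<r⇒p<q⊓r {p} {q} {r} p<q p<r with ⊓-sel q r
... | inj₁ q⊓r≡q = subst (p <_) (sym q⊓r≡q) p<q
... | inj₂ q⊓r≡r = subst (p <_) (sym q⊓r≡r) p<r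

∃-strictUpperBound : (f : Fin n → ℚ) → ∃[ M ] (∀ i → f i < M)
∃-strictUpperBound {ℕ.zero} f = 0ℚ , λ ()
∃-strictUpperBound {ℕ.suc n} f with ∃-strictUpperBound (f ∘ suc)
... | M , f∘suc<M = (f zero + 1ℚ) ⊔ M , λ where
  zero    → <-≤-trans (p<p+q (f zero) (positive⁻¹ 1ℚ)) (p≤p⊔q _ M)
  (suc i) → <-≤-trans (f∘suc<M i) (p≤q⇒p≤r⊔q (f zero + 1ℚ) ≤-refl)

∃-positiveLowerBound : (f : Fin n → ℚ) → ∃[ ε ] (0ℚ < ε × ∀ i → 0ℚ < f i → ε ≤ f i)
∃-positiveLowerBound {ℕ.zero} f = 1ℚ , positive⁻¹ 1ℚ , λ ()
∃-positiveLowerBound {ℕ.suc n} f with ∃-positiveLowerBound (f ∘ suc) | 0ℚ <? f zero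
... | ε , 0<ε , ε≤f∘suc | no 0≮f0 = ε , 0<ε , λ where
  zero 0<f0     → ⊥-elim (0≮f0 0<f0)
  (suc i) 0<fi  → ε≤f∘suc i 0<fi
... | ε , 0<ε , ε≤f∘suc | yes 0<f0 = f zero ⊓ ε , p<q⇒p<r⇒p<q⊓r 0<f0 0<ε , λ where
  zero _        → p⊓q≤p (f zero) ε
  (suc i) 0<fi  → p≤q⇒r⊓p≤q (f zero) (ε≤f∘suc i 0<fi)

∃-positiveLowerBound₂ : ∀ {m} (f : Fin m → Fin n → ℚ) →
  ∃[ ε ] (0ℚ < ε × ∀ i j → 0ℚ < f i j → ε ≤ f i j)
∃-positiveLowerBound₂ f with ∃-positiveLowerBound (proj₁ ∘ ∃-positiveLowerBound ∘ f)
... | ε , 0<ε , ε≤ = ε , 0<ε , λ i j 0<fij →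
  let εᵢ , 0<εᵢ , εᵢ≤ = ∃-positiveLowerBound (f i) in ≤-trans (ε≤ i 0<εᵢ) (εᵢ≤ j 0<fij)

∃-separation : (l r : Fin n → ℚ) →
  ∃[ ε ] (0ℚ < ε × ∀ a b → (0ℚ ≤ l a - (r b + ε)) ⇔ (r b < l a))
∃-separation l r with ∃-positiveLowerBound₂ (λ a b → l a - r b)
... | ε , 0<ε , ε≤gap = ε , 0<ε , λ a b → mk⇔ (separated a b) (gapped a b)
  where
  reassoc : ∀ a b → l a - (r b + ε) ≡ (l a - r b) - ε
  reassoc a b = solve 3 (λ x y e → x :- (y :+ e) := (x :- y) :- e) refl (l a) (r b) ε
  separated : ∀ a b → 0ℚ ≤ l a - (r b + ε) → r b < l a
  separated a b 0≤ = <-≤-trans (p<p+q (r b) 0<ε)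
    (0≤q-p⇒p≤q {r b + ε} {l a} 0≤)
  gapped : ∀ a b → r b < l a → 0ℚ ≤ l a - (r b + ε)
  gapped a b rb<la = subst (0ℚ ≤_) (sym (reassoc a b))
    (p≤q⇒0≤q-p (ε≤gap a b (p<q⇒0<q-p rb<la)))

Adj-irrefl : (G : Graph n) (v : Fin n) → ¬ Adj G v v
Adj-irrefl G v vv with () ← trans (sym (irrefl G v)) vv

Adj-sym : (G : Graph n) {u v : Fin n} → Adj G u v ⇔ Adj G v u
Adj-sym G {u} {v} = mk⇔ (trans (symm G v u)) (trans (symm G u v))

Adj-complement : (G : Graph n) {u v : Fin n} → u ≢ v → Adj (complement G) u v ⇔ (¬ Adj G u v)
Adj-complement G {u} {v} u≢v with u ≟ v
... | yes u≡v = ⊥-elim (u≢v u≡v)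
... | no _ with adj G u v
...   | true  = mk⇔ (λ ()) (λ ¬uv → ⊥-elim (¬uv refl))
...   | false = mk⇔ (λ _ ()) (λ _ → refl)

thresholdGraph : ℚ → (Fin n → ℚ) → Graph n
thresholdGraph {n} S w = record { adj = adjacent ; symm = adjacent-sym ; irrefl = adjacent-irrefl }
  where
  adjacent : Fin n → Fin n → Bool
  adjacent u v = not ⌊ u ≟ v ⌋ ∧ ⌊ S ≤? w u + w v ⌋
  adjacent-sym : ∀ u v → adjacent u v ≡ adjacent v u
  adjacent-sym u v with u ≟ v | v ≟ u
  ... | yes _    | yes _    = refl
  ... | yes refl | no v≢u   = ⊥-elim (v≢u refl)
  ... | no u≢v   | yes refl = ⊥-elim (u≢v refl)
  ... | no _     | no _     = cong (λ x → ⌊ S ≤? x ⌋) (+-comm (w u) (w v))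
  adjacent-irrefl : ∀ v → adjacent v v ≡ false
  adjacent-irrefl v with v ≟ v
  ... | yes _   = refl
  ... | no v≢v  = ⊥-elim (v≢v refl)

Adj-thresholdGraph : ∀ S (w : Fin n → ℚ) {u v} → u ≢ v →
  Adj (thresholdGraph S w) u v ⇔ (S ≤ w u + w v)
Adj-thresholdGraph S w {u} {v} u≢v with u ≟ v
... | yes u≡v = ⊥-elim (u≢v u≡v)
... | no _ with S ≤? w u + w v
...   | yes S≤ = mk⇔ (λ _ → S≤) (λ _ → refl)
...   | no S≰  = mk⇔ (λ ()) (⊥-elim ∘ S≰)

thresholdGraph-isThreshold : ∀ S (w : Fin n → ℚ) → IsThreshold (thresholdGraph S w)
thresholdGraph-isThreshold S w = S , w , λ u v → Adj-thresholdGraph S w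

thresholdDim≤2 : (G H₁ H₂ : Graph n) → IsThreshold H₁ → IsThreshold H₂ →
  (∀ u v → u ≢ v → Adj G u v ⇔ (Adj H₁ u v ⊎ Adj H₂ u v)) → ThresholdDimAtMost G 2
thresholdDim≤2 {n} G H₁ H₂ H₁-threshold H₂-threshold G≡H₁∪H₂ =
  2 , ℕ-≤-refl , Hs , Hs-threshold , G≡⋃Hs
  where
  Hs : Fin 2 → Graph n
  Hs = H₁ ∷ H₂ ∷ []
  Hs-threshold : ∀ i → IsThreshold (Hs i)
  Hs-threshold zero       = H₁-threshold
  Hs-threshold (suc zero) = H₂-threshold
  ⋃Hs⇔⊎ : ∀ {u v} → (∃[ i ] Adj (Hs i) u v) ⇔ (Adj H₁ u v ⊎ Adj H₂ u v)
  ⋃Hs⇔⊎ = mk⇔ (λ { (zero , uv) → inj₁ uv ; (suc zero , uv) → inj₂ uv ; (suc (suc ()) , _) })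
               [ (zero ,_) , (suc zero ,_) ]
  G≡⋃Hs : ∀ u v → Adj G u v ⇔ (∃[ i ] Adj (Hs i) u v)
  G≡⋃Hs u v with u ≟ v
  ... | yes refl = mk⇔ (⊥-elim ∘ Adj-irrefl G u) (λ (i , uu) → ⊥-elim (Adj-irrefl (Hs i) u uu))
  ... | no u≢v   = ⇔-sym ⋃Hs⇔⊎ ⇔-∘ G≡H₁∪H₂ u v u≢v

module SplitWeighting {n : ℕ} (inK : Fin n → Bool) (p q : Fin n → ℚ) where

  private
    bound : ∃[ M ] (∀ v → p v ⊔ - q v < M)
    bound = ∃-strictUpperBound (λ v → p v ⊔ - q v)

    M : ℚ
    M = proj₁ bound

    p<M : ∀ v → p v < M
    p<M v = ≤-<-trans (p≤p⊔q (p v) (- q v)) (proj₂ bound v)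

    -q≤M : ∀ v → - q v ≤ M
    -q≤M v = <⇒≤ (≤-<-trans (p≤q⊔p (p v) (- q v)) (proj₂ bound v))

  weight : Fin n → ℚ
  weight v = if inK v then p v - M else q v + M

  graph : Graph n
  graph = thresholdGraph 0ℚ weight

  graph-isThreshold : IsThreshold graph
  graph-isThreshold = thresholdGraph-isThreshold 0ℚ weight

  private
    weight-clique : ∀ {v} → inK v ≡ true → weight v ≡ p v - M
    weight-clique {v} Kv = cong (if_then p v - M else q v + M) Kv

    weight-independent : ∀ {v} → inK v ≡ false → weight v ≡ q v + M
    weight-independent {v} Iv = cong (if_then p v - M else q v + M) Iv

  ¬Adj-clique : ∀ {u v} → u ≢ v → inK u ≡ true → inK v ≡ true → ¬ Adj graph u v
  ¬Adj-clique {u} {v} u≢v Ku Kv uv = <⇒≱ negative (to (Adj-thresholdGraph 0ℚ weight u≢v) uv)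
    where
    negative : weight u + weight v < 0ℚ
    negative = subst₂ _<_ (sym (cong₂ _+_ (weight-clique Ku) (weight-clique Kv))) (+-identityˡ 0ℚ)
      (+-mono-< (p<q⇒p-q<0 (p<M u)) (p<q⇒p-q<0 (p<M v)))

  Adj-independent : ∀ {u v} → u ≢ v → inK u ≡ false → inK v ≡ false → Adj graph u v
  Adj-independent {u} {v} u≢v Iu Iv = from (Adj-thresholdGraph 0ℚ weight u≢v) nonNegative
    where
    nonNegative : 0ℚ ≤ weight u + weight v
    nonNegative = subst₂ _≤_ (+-identityˡ 0ℚ) (sym (cong₂ _+_ (weight-independent Iu) (weight-independent Iv)))
      (+-mono-≤ (-p≤q⇒0≤p+q (-q≤M u)) (-p≤q⇒0≤p+q (-q≤M v)))

  Adj-cross : ∀ {u v} → u ≢ v → inK u ≡ true → inK v ≡ false → Adj graph u v ⇔ (0ℚ ≤ p u + q v)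
  Adj-cross {u} {v} u≢v Ku Iv =
    subst (λ x → Adj graph u v ⇔ (0ℚ ≤ x)) weight-sum (Adj-thresholdGraph 0ℚ weight u≢v)
    where
    weight-sum : weight u + weight v ≡ p u + q v
    weight-sum = trans (cong₂ _+_ (weight-clique Ku) (weight-independent Iv))
      (solve 3 (λ x y m → (x :- m) :+ (y :+ m) := x :+ y) refl (p u) (q v) M)

¬Adj⇔disjoint : (G : Graph n) (l r : Fin n → ℚ) →
  (∀ u v → u ≢ v → Adj G u v ⇔ (l u ≤ r v × l v ≤ r u)) →
  ∀ {u v} → u ≢ v → (¬ Adj G u v) ⇔ (r v < l u ⊎ r u < l v)
¬Adj⇔disjoint G l r intersecting {u} {v} u≢v = mk⇔ disjoint nonadjacent
  where
  nonadjacent : r v < l u ⊎ r u < l v → ¬ Adj G u v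
  nonadjacent (inj₁ rv<lu) uv = <⇒≱ rv<lu (proj₁ (to (intersecting u v u≢v) uv))
  nonadjacent (inj₂ ru<lv) uv = <⇒≱ ru<lv (proj₂ (to (intersecting u v u≢v) uv))
  disjoint : ¬ Adj G u v → r v < l u ⊎ r u < l v
  disjoint ¬uv with l u ≤? r v | l v ≤? r u
  ... | no lu≰rv  | _         = inj₁ (≰⇒> lu≰rv)
  ... | yes _     | no lv≰ru  = inj₂ (≰⇒> lv≰ru)
  ... | yes lu≤rv | yes lv≤ru = ⊥-elim (¬uv (from (intersecting u v u≢v) (lu≤rv , lv≤ru)))

module SplitIntervalComplement {n : ℕ} (G : Graph n) (inK : Fin n → Bool)
  (clique : ∀ u v → u ≢ v → inK u ≡ true → inK v ≡ true → Adj G u v)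
  (independent : ∀ u v → inK u ≡ false → inK v ≡ false → ¬ Adj G u v)
  (l r : Fin n → ℚ)
  (intersecting : ∀ u v → u ≢ v → Adj G u v ⇔ (l u ≤ r v × l v ≤ r u)) where

  private
    separation : ∃[ ε ] (0ℚ < ε × ∀ a b → (0ℚ ≤ l a - (r b + ε)) ⇔ (r b < l a))
    separation = ∃-separation l r

    ε : ℚ
    ε = proj₁ separation

    separated : ∀ a b → (0ℚ ≤ l a - (r b + ε)) ⇔ (r b < l a)
    separated = proj₂ (proj₂ separation)

  module H₁ = SplitWeighting inK l (λ b → - (r b + ε))
  module H₂ = SplitWeighting inK (λ a → - (r a + ε)) l

  ¬Adj⇔cover-cross : ∀ {u v} → u ≢ v → inK u ≡ true → inK v ≡ false →
    (¬ Adj G u v) ⇔ (Adj H₁.graph u v ⊎ Adj H₂.graph u v)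
  ¬Adj⇔cover-cross {u} {v} u≢v Ku Iv = (right ⊎-⇔ left) ⇔-∘ ¬Adj⇔disjoint G l r intersecting u≢v
    where
    right : (r v < l u) ⇔ Adj H₁.graph u v
    right = ⇔-sym (separated u v ⇔-∘ H₁.Adj-cross u≢v Ku Iv)
    left : (r u < l v) ⇔ Adj H₂.graph u v
    left = ⇔-sym (separated v u ⇔-∘
      subst (λ x → Adj H₂.graph u v ⇔ (0ℚ ≤ x)) (+-comm (- (r u + ε)) (l v)) (H₂.Adj-cross u≢v Ku Iv))

  ¬Adj⇔cover : ∀ {u v} → u ≢ v → (¬ Adj G u v) ⇔ (Adj H₁.graph u v ⊎ Adj H₂.graph u v)
  ¬Adj⇔cover {u} {v} u≢v = byParts (inK u) (inK v) refl refl
    where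
    byParts : ∀ a b → inK u ≡ a → inK v ≡ b →
      (¬ Adj G u v) ⇔ (Adj H₁.graph u v ⊎ Adj H₂.graph u v)
    byParts true true Ku Kv = mk⇔ (λ ¬uv → ⊥-elim (¬uv (clique u v u≢v Ku Kv)))
      [ ⊥-elim ∘ H₁.¬Adj-clique u≢v Ku Kv , ⊥-elim ∘ H₂.¬Adj-clique u≢v Ku Kv ]
    byParts false false Iu Iv =
      mk⇔ (λ _ → inj₁ (H₁.Adj-independent u≢v Iu Iv)) (λ _ → independent u v Iu Iv)
    byParts true false Ku Iv = ¬Adj⇔cover-cross u≢v Ku Iv
    byParts false true Iu Kv = (Adj-sym H₁.graph ⊎-⇔ Adj-sym H₂.graph)
      ⇔-∘ (¬Adj⇔cover-cross (u≢v ∘ sym) Kv Iu ⇔-∘ ¬-cong-⇔ (Adj-sym G))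

  complement-thresholdDim≤2 : ThresholdDimAtMost (complement G) 2
  complement-thresholdDim≤2 = thresholdDim≤2 (complement G) H₁.graph H₂.graph
    H₁.graph-isThreshold H₂.graph-isThreshold
    (λ u v u≢v → ¬Adj⇔cover u≢v ⇔-∘ Adj-complement G u≢v)

lemma5 : ∀ (n : ℕ) (G : Graph n) → IsSplitInterval G → ThresholdDimAtMost (complement G) 2
lemma5 n G ((inK , clique , independent) , (l , r , _ , intersecting)) =
  SplitIntervalComplement.complement-thresholdDim≤2 G inK clique independent l r intersecting
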